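{- Let $\mathsf{K}$ be a positive universal class of pointed lattices, axiomatized by a set $\{\Phi_i : i\in I\}$ of sentences each of the form $\Phi = (t_1 \leq u_1 \text{ or } \dots \text{ or } t_k \leq u_k)$ (universally quantified, $t_j,u_j$ pointed lattice terms). For each such $\Phi$ let $\mathrm{Pre}(\Phi)$ be the RL equation $(\mathsf{1}\wedge (t_1\backslash u_1)) \vee \dots \vee (\mathsf{1}\wedge (t_k\backslash u_k)) \approx \mathsf{1}$. Then for every RL $\mathbf{A}$ the following are equivalent: (i) $\mathbf{A}$ satisfies $\mathrm{Pre}(\Phi_i)$ for all $i\in I$ (i.e. $\mathbf{A}$ is left pre-$\mathsf{K}$); (ii) every meet irreducible element of the lattice $\mathrm{Fi}_{\ast}\mathbf{A}$ is a left $\mathsf{K}$-filter; (ii') every completely meet irreducible element of $\mathrm{Fi}_{\ast}\mathbf{A}$ is a left $\mathsf{K}$-filter; (iii) ${\uparrow}\mathsf{1}$ is an intersection of left $\mathsf{K}$-filters of $\mathbf{A}$; (iv) every $F\in \mathrm{Fi}_{\ast}\mathbf{A}$ is an intersection of left $\mathsf{K}$-filters of $\mathbf{A}$.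
   Context: A pointed lattice is a lattice with a constant $\mathsf{1}$. A residuated lattice (RL) is an algebra $\langle A; \wedge, \vee, \cdot, \mathsf{1}, \backslash, / \rangle$ with a lattice reduct, a monoid reduct $\langle A;\cdot,\mathsf{1}\rangle$, and $x \leq z/y \iff x\cdot y \leq z \iff y \leq x\backslash z$. A multiplicative $\mathsf{1}$-filter of a RL $\mathbf{A}$ is a lattice filter $F$ containing $\mathsf{1}$ and closed under $\cdot$; $\mathrm{Fi}_{\ast}\mathbf{A}$ denotes the lattice of these ordered by inclusion. For such $F$, $\mathrm{L}\Theta(F)$ is the relation $\langle x,y\rangle\in \mathrm{L}\Theta(F) \iff x\backslash y\in F$ and $y\backslash x\in F$; it is a lattice congruence, and $\mathbf{A}/\mathrm{L}\Theta(F)$ denotes the resulting quotient pointed lattice (with constant the class of $\mathsf{1}$). $F$ is a left $\mathsf{K}$-filter if $\mathbf{A}/\mathrm{L}\Theta(F)\in\mathsf{K}$ as a pointed lattice. An intersection of an empty family of filters is the whole universe. -}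

module Defs where

open import Level using (Level; 0ℓ) renaming (suc to lsuc)
open import Data.Nat using (ℕ)
open import Data.Product using (Σ; _×_; _,_; proj₁; proj₂)
open import Data.Sum using (_⊎_)
open import Data.List.NonEmpty using (List⁺; toList; foldr₁) renaming (map to map⁺)
open import Data.List.Relation.Unary.Any using (Any)
open import Relation.Nullary using (¬_)
open import Relation.Unary using (Pred; _∈_; _⊆_; _∩_; U)
open import Relation.Binary.Core using (Rel)
open import Relation.Binary.Structures using (IsEquivalence)
open import Relation.Binary.PropositionalEquality
  using (_≡_; refl; sym; trans; cong; cong₂; subst)
open import Function.Bundles using (_⇔_; Equivalence)
open import Algebra.Core using (Op₂)
open import Algebra.Structures using (IsMonoid)
open import Algebra.Lattice.Structures using (IsLattice)
open import Algebra.Lattice.Bundles using (Lattice)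
import Algebra.Lattice.Properties.Lattice as LatticeProps
import Relation.Binary.Lattice.Structures as OrderLattice

record PointedLattice : Set₁ where
  field
    lattice : Lattice 0ℓ 0ℓ
  open Lattice lattice public
  field
    𝟏 : Carrier

infixr 7 _∧ₜ_
infixr 6 _∨ₜ_

data Term : Set where
  var   : ℕ → Term
  _∧ₜ_  : Term → Term → Term
  _∨ₜ_  : Term → Term → Term
  𝟏ₜ    : Term

-- an atomic formula  t ≤ u  is the pair (t , u)
Atom : Set
Atom = Term × Term

-- a disjunction of (at least one) atomic formulas
Sentence : Set
Sentence = List⁺ Atom

eval : {A : Set} → Op₂ A → Op₂ A → A → (ℕ → A) → Term → A
eval _∧_ _∨_ one ρ (var n)  = ρ n
eval _∧_ _∨_ one ρ (t ∧ₜ u) = eval _∧_ _∨_ one ρ t ∧ eval _∧_ _∨_ one ρ u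
eval _∧_ _∨_ one ρ (t ∨ₜ u) = eval _∧_ _∨_ one ρ t ∨ eval _∧_ _∨_ one ρ u
eval _∧_ _∨_ one ρ 𝟏ₜ       = one

module _ (L : PointedLattice) where
  open PointedLattice L

  ⟦_⟧ : Term → (ℕ → Carrier) → Carrier
  ⟦ t ⟧ ρ = eval _∧_ _∨_ 𝟏 ρ t

  SatAtom : (ℕ → Carrier) → Atom → Set
  SatAtom ρ (t , u) = ⟦ t ⟧ ρ ≈ (⟦ t ⟧ ρ ∧ ⟦ u ⟧ ρ)

  _⊨_ : Sentence → Set
  _⊨_ Φ = ∀ (ρ : ℕ → Carrier) → Any (SatAtom ρ) (toList Φ)

InClass : {I : Set} → (I → Sentence) → PointedLattice → Set
InClass Φ L = ∀ i → L ⊨ Φ i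

LeftNatOrder : {A : Set} → Op₂ A → Rel A 0ℓ
LeftNatOrder _∧_ x y = x ≡ (x ∧ y)

record ResiduatedLattice : Set₁ where
  infixr 7 _∧_
  infixr 6 _∨_
  infixl 8 _·_
  infixr 9 _\\_
  infixl 9 _/_
  field
    Carrier    : Set
    _∧_        : Op₂ Carrier
    _∨_        : Op₂ Carrier
    _·_        : Op₂ Carrier
    𝟏          : Carrier
    _\\_       : Op₂ Carrier
    _/_        : Op₂ Carrier
    isLattice  : IsLattice _≡_ _∨_ _∧_
    ·-isMonoid : IsMonoid _≡_ _·_ 𝟏
    residuation : ∀ x y z →
      (LeftNatOrder _∧_ x (z / y) ⇔ LeftNatOrder _∧_ (x · y) z) ×
      (LeftNatOrder _∧_ (x · y) z ⇔ LeftNatOrder _∧_ y (x \\ z))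

  infix 4 _≤_
  _≤_ : Rel Carrier 0ℓ
  _≤_ = LeftNatOrder _∧_

  lattice : Lattice 0ℓ 0ℓ
  lattice = record { Carrier = Carrier ; _≈_ = _≡_ ; _∨_ = _∨_ ; _∧_ = _∧_
                   ; isLattice = isLattice }

module _ (A : ResiduatedLattice) where
  open ResiduatedLattice A

  ⟦_⟧ᴬ : Term → (ℕ → Carrier) → Carrier
  ⟦ t ⟧ᴬ ρ = eval _∧_ _∨_ 𝟏 ρ t

  preTerm : (ℕ → Carrier) → Sentence → Carrier
  preTerm ρ Φ = foldr₁ _∨_ (map⁺ (λ a → 𝟏 ∧ (⟦ proj₁ a ⟧ᴬ ρ \\ ⟦ proj₂ a ⟧ᴬ ρ)) Φ)

  SatisfiesPre : Sentence → Set
  SatisfiesPre Φ = ∀ (ρ : ℕ → Carrier) → preTerm ρ Φ ≡ 𝟏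

module _ (A : ResiduatedLattice) where
  open ResiduatedLattice A

  record IsMFilter (F : Pred Carrier 0ℓ) : Set where
    field
      upward  : ∀ {x y} → x ∈ F → x ≤ y → y ∈ F
      ∧-closed : ∀ {x y} → x ∈ F → y ∈ F → (x ∧ y) ∈ F
      𝟏∈      : 𝟏 ∈ F
      ·-closed : ∀ {x y} → x ∈ F → y ∈ F → (x · y) ∈ F

  record MFilter : Set₁ where
    field
      pred      : Pred Carrier 0ℓ
      isMFilter : IsMFilter pred
    open IsMFilter isMFilter public

  open MFilter

  _≐_ : ∀ {ℓ₁ ℓ₂} → Pred Carrier ℓ₁ → Pred Carrier ℓ₂ → Set _
  P ≐ Q = (P ⊆ Q) × (Q ⊆ P)

  -- the intersection of a set S of multiplicative 1-filters
  -- (the intersection of the empty family is the whole universe)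
  ⋂ : Pred MFilter (lsuc 0ℓ) → Pred Carrier (lsuc 0ℓ)
  ⋂ S x = ∀ (G : MFilter) → S G → x ∈ pred G

  -- meet irreducible in Fi∗ A (meets of two filters are intersections;
  -- the top element A itself is not meet irreducible)
  MeetIrreducible : MFilter → Set₁
  MeetIrreducible F =
    ¬ (pred F ≐ U) ×
    (∀ (G H : MFilter) → pred F ≐ (pred G ∩ pred H) →
       (pred F ≐ pred G) ⊎ (pred F ≐ pred H))

  -- completely meet irreducible in Fi∗ A (meets in Fi∗ A are intersections)
  CompletelyMeetIrreducible : MFilter → Set₂
  CompletelyMeetIrreducible F =
    ∀ (S : Pred MFilter (lsuc 0ℓ)) → pred F ≐ ⋂ S →
      Σ MFilter (λ G → S G × (pred F ≐ pred G))

  ↑𝟏 : Pred Carrier 0ℓ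
  ↑𝟏 x = 𝟏 ≤ x

  LΘ : MFilter → Rel Carrier 0ℓ
  LΘ F x y = ((x \\ y) ∈ pred F) × ((y \\ x) ∈ pred F)

  private
    module LP = LatticeProps lattice
    module OL = OrderLattice.IsLattice LP.∨-∧-isOrderTheoreticLattice
    module M = IsMonoid ·-isMonoid
    module Lt = IsLattice isLattice

    ≤-refl : ∀ {x} → x ≤ x
    ≤-refl = OL.refl
    ≤-trans : ∀ {x y z} → x ≤ y → y ≤ z → x ≤ z
    ≤-trans = OL.trans

    res₁ : ∀ {x y z} → x ≤ z / y → x · y ≤ z
    res₁ {x} {y} {z} = Equivalence.to (proj₁ (residuation x y z))
    res₁⁻ : ∀ {x y z} → x · y ≤ z → x ≤ z / y
    res₁⁻ {x} {y} {z} = Equivalence.from (proj₁ (residuation x y z))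
    res₂ : ∀ {x y z} → x · y ≤ z → y ≤ x \\ z
    res₂ {x} {y} {z} = Equivalence.to (proj₂ (residuation x y z))
    res₂⁻ : ∀ {x y z} → y ≤ x \\ z → x · y ≤ z
    res₂⁻ {x} {y} {z} = Equivalence.from (proj₂ (residuation x y z))

    monoʳ : ∀ {a b c} → a ≤ b → c · a ≤ c · b
    monoʳ a≤b = res₂⁻ (≤-trans a≤b (res₂ ≤-refl))
    monoˡ : ∀ {a b c} → a ≤ b → a · c ≤ b · c
    monoˡ a≤b = res₁ (≤-trans a≤b (res₁⁻ ≤-refl))

    ev : ∀ {x y} → x · (x \\ y) ≤ y
    ev = res₂⁻ ≤-refl

    ≤-≡ : ∀ {x y z} → x ≡ y → y ≤ z → x ≤ z
    ≤-≡ refl p = p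

    𝟏≤x\x : ∀ {x} → 𝟏 ≤ x \\ x
    𝟏≤x\x = res₂ (≤-≡ (M.identityʳ _) ≤-refl)

    comp : ∀ {x y z} → (x \\ y) · (y \\ z) ≤ x \\ z
    comp = res₂ (≤-≡ (sym (M.assoc _ _ _)) (≤-trans (monoˡ ev) ev))

    meetL : ∀ {x y x' y'} → (x \\ x') ∧ (y \\ y') ≤ (x ∧ y) \\ (x' ∧ y')
    meetL = res₂ (OL.∧-greatest
      (≤-trans (monoˡ (OL.x∧y≤x _ _)) (≤-trans (monoʳ (OL.x∧y≤x _ _)) ev))
      (≤-trans (monoˡ (OL.x∧y≤y _ _)) (≤-trans (monoʳ (OL.x∧y≤y _ _)) ev)))

    joinL : ∀ {x y x' y'} → (x \\ x') ∧ (y \\ y') ≤ (x ∨ y) \\ (x' ∨ y')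
    joinL = res₂ (res₁ (OL.∨-least
      (res₁⁻ (≤-trans (monoʳ (OL.x∧y≤x _ _)) (≤-trans ev (OL.x≤x∨y _ _))))
      (res₁⁻ (≤-trans (monoʳ (OL.x∧y≤y _ _)) (≤-trans ev (OL.y≤x∨y _ _))))))

  module _ (F : MFilter) where
    private
      Θ = LΘ F

      Θ-refl : ∀ {x} → Θ x x
      Θ-refl = upward F (𝟏∈ F) 𝟏≤x\x , upward F (𝟏∈ F) 𝟏≤x\x

      ≡⇒Θ : ∀ {x y} → x ≡ y → Θ x y
      ≡⇒Θ refl = Θ-refl

      Θ-sym : ∀ {x y} → Θ x y → Θ y x
      Θ-sym (p , q) = q , p

      Θ-trans : ∀ {x y z} → Θ x y → Θ y z → Θ x z
      Θ-trans (p , q) (r , s) =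
        upward F (·-closed F p r) comp , upward F (·-closed F s q) comp

      Θ-∧ : ∀ {x x' y y'} → Θ x x' → Θ y y' → Θ (x ∧ y) (x' ∧ y')
      Θ-∧ (p , q) (r , s) =
        upward F (∧-closed F p r) meetL , upward F (∧-closed F q s) meetL

      Θ-∨ : ∀ {x x' y y'} → Θ x x' → Θ y y' → Θ (x ∨ y) (x' ∨ y')
      Θ-∨ (p , q) (r , s) =
        upward F (∧-closed F p r) joinL , upward F (∧-closed F q s) joinL

      Θ-isLattice : IsLattice Θ _∨_ _∧_
      Θ-isLattice = record
        { isEquivalence = record { refl = Θ-refl ; sym = Θ-sym ; trans = Θ-trans }
        ; ∨-comm  = λ x y → ≡⇒Θ (Lt.∨-comm x y)
        ; ∨-assoc = λ x y z → ≡⇒Θ (Lt.∨-assoc x y z)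
        ; ∨-cong  = Θ-∨
        ; ∧-comm  = λ x y → ≡⇒Θ (Lt.∧-comm x y)
        ; ∧-assoc = λ x y z → ≡⇒Θ (Lt.∧-assoc x y z)
        ; ∧-cong  = Θ-∧
        ; absorptive = (λ x y → ≡⇒Θ (Lt.∨-absorbs-∧ x y))
                     , (λ x y → ≡⇒Θ (Lt.∧-absorbs-∨ x y))
        }

    -- the quotient pointed lattice A / LΘ(F), presented as the setoid
    -- (Carrier, LΘ(F)) with the operations of A and constant 1
    Quotient : PointedLattice
    Quotient = record
      { lattice = record { Carrier = Carrier ; _≈_ = Θ ; _∨_ = _∨_ ; _∧_ = _∧_
                         ; isLattice = Θ-isLattice }
      ; 𝟏 = 𝟏 }

  IsLeftKFilter : {I : Set} → (I → Sentence) → MFilter → Set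
  IsLeftKFilter Φ F = InClass Φ (Quotient F)

  IsIntersectionOfLeftKFilters : ∀ {ℓ} {I : Set} → (I → Sentence) →
                                 Pred Carrier ℓ → Set _
  IsIntersectionOfLeftKFilters Φ P =
    Σ (Pred MFilter (lsuc 0ℓ)) λ S →
      (∀ G → S G → IsLeftKFilter Φ G) × (P ≐ ⋂ S)

-- Classical ambient logic (the paper works in ZFC): Zorn's lemma for
-- preorders, stated for types at level a, relations at level r and
-- chains given as predicates at level c.

Zorn : (a r c : Level) → Set (lsuc (a Level.⊔ r Level.⊔ c))
Zorn a r c =
  (P : Set a) (_≤_ : P → P → Set r) →
  (∀ {x} → x ≤ x) → (∀ {x y z} → x ≤ y → y ≤ z → x ≤ z) →
  ((C : Pred P c) → (∀ {x y} → C x → C y → (x ≤ y) ⊎ (y ≤ x)) →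
     Σ P (λ u → ∀ {x} → C x → x ≤ u)) →
  Σ P (λ m → ∀ y → m ≤ y → y ≤ m)

-- (i) ⇒ (ii): a meet irreducible filter F is prime on negative elements, because
-- if a ∨ b ∈ F with a, b ≤ 1, then the filters generated by F ∪ {a} and F ∪ {b}
-- meet in F; so whenever the join of the elements 1 ∧ (tⱼ \ uⱼ) is 1 ∈ F, one of
-- them lies in F, which says exactly that tⱼ ≤ uⱼ holds in A / LΘ(F).
-- (ii') ⇒ (iv): by Zorn's lemma every filter is the intersection of the filters
-- maximal among those containing it and omitting a given x, and these are
-- completely meet irreducible.
-- (iii) ⇒ (i): each left K-filter contains the term of Pre(Φ), so ↑1 does.

module Submission where

open import Defs
open import Level using (0ℓ; Lift; lift; lower) renaming (suc to lsuc)
open import Data.Nat using (ℕ; zero; suc; _+_)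
open import Data.Nat.Properties using (+-suc)
open import Data.Product using (Σ; Σ-syntax; _×_; _,_; proj₁; proj₂)
open import Data.Sum using (_⊎_; inj₁; inj₂)
import Data.Sum as Sum
open import Data.Empty using (⊥; ⊥-elim)
open import Data.Unit using (tt)
open import Data.List using ([]; _∷_)
open import Data.List.NonEmpty using (List⁺; _∷_; toList; foldr₁) renaming (map to map⁺)
open import Data.List.Relation.Unary.Any using (Any; here; there)
import Data.List.Relation.Unary.Any as Any
open import Relation.Nullary using (Dec; yes; no)
open import Relation.Nullary.Decidable using (True; toWitness; fromWitness; map′; decidable-stable)
open import Relation.Unary using (Pred; _∈_; _∉_; _⊆_; _∩_; U)
open import Relation.Binary.PropositionalEquality using (_≡_; refl; sym; subst)
open import Function using (_∘_)
open import Function.Bundles using (_⇔_; Equivalence; mk⇔)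
open import Algebra.Structures using (IsMonoid)
import Algebra.Lattice.Properties.Lattice as LatticeProperties
import Relation.Binary.Lattice.Structures as OrderLattice
open import Axiom.ExcludedMiddle using (ExcludedMiddle)

module ResiduatedLatticeProperties (A : ResiduatedLattice) where
  open ResiduatedLattice A
  private
    module M = IsMonoid ·-isMonoid

  open OrderLattice.IsLattice (LatticeProperties.∨-∧-isOrderTheoreticLattice lattice) public
    using (∧-greatest; ∨-least; x∧y≤x; x∧y≤y; x≤x∨y; y≤x∨y)
    renaming (refl to ≤-refl; reflexive to ≤-reflexive; trans to ≤-trans; antisym to ≤-antisym)

  rdiv-elim : ∀ {x y z} → x ≤ z / y → x · y ≤ z
  rdiv-elim = Equivalence.to (proj₁ (residuation _ _ _))

  rdiv-intro : ∀ {x y z} → x · y ≤ z → x ≤ z / y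
  rdiv-intro = Equivalence.from (proj₁ (residuation _ _ _))

  ldiv-intro : ∀ {x y z} → x · y ≤ z → y ≤ x \\ z
  ldiv-intro = Equivalence.to (proj₂ (residuation _ _ _))

  ldiv-elim : ∀ {x y z} → y ≤ x \\ z → x · y ≤ z
  ldiv-elim = Equivalence.from (proj₂ (residuation _ _ _))

  ldiv-eval : ∀ {x y} → x · (x \\ y) ≤ y
  ldiv-eval = ldiv-elim ≤-refl

  ·-monoʳ-≤ : ∀ {x y z} → y ≤ z → x · y ≤ x · z
  ·-monoʳ-≤ y≤z = ldiv-elim (≤-trans y≤z (ldiv-intro ≤-refl))

  ·-monoˡ-≤ : ∀ {x y z} → x ≤ y → x · z ≤ y · z
  ·-monoˡ-≤ x≤y = rdiv-elim (≤-trans x≤y (rdiv-intro ≤-refl))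

  ∧-monoˡ-≤ : ∀ {x y z} → x ≤ y → x ∧ z ≤ y ∧ z
  ∧-monoˡ-≤ x≤y = ∧-greatest (≤-trans (x∧y≤x _ _) x≤y) (x∧y≤y _ _)

  ∨-mono-≤ : ∀ {x x′ y y′} → x ≤ x′ → y ≤ y′ → x ∨ y ≤ x′ ∨ y′
  ∨-mono-≤ x≤x′ y≤y′ = ∨-least (≤-trans x≤x′ (x≤x∨y _ _)) (≤-trans y≤y′ (y≤x∨y _ _))

  ·-distribˡ-∨-≤ : ∀ {x y z} → x · (y ∨ z) ≤ x · y ∨ x · z
  ·-distribˡ-∨-≤ = ldiv-elim (∨-least (ldiv-intro (x≤x∨y _ _)) (ldiv-intro (y≤x∨y _ _)))

  ·-distribʳ-∨-≤ : ∀ {x y z} → (y ∨ z) · x ≤ y · x ∨ z · x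
  ·-distribʳ-∨-≤ = rdiv-elim (∨-least (rdiv-intro (x≤x∨y _ _)) (rdiv-intro (y≤x∨y _ _)))

  x≤𝟏⇒x·y≤y : ∀ {x y} → x ≤ 𝟏 → x · y ≤ y
  x≤𝟏⇒x·y≤y x≤𝟏 = ≤-trans (·-monoˡ-≤ x≤𝟏) (≤-reflexive (M.identityˡ _))

  y≤𝟏⇒x·y≤x : ∀ {x y} → y ≤ 𝟏 → x · y ≤ x
  y≤𝟏⇒x·y≤x y≤𝟏 = ≤-trans (·-monoʳ-≤ y≤𝟏) (≤-reflexive (M.identityʳ _))

  𝟏≤x⇒y≤x·y : ∀ {x y} → 𝟏 ≤ x → y ≤ x · y
  𝟏≤x⇒y≤x·y 𝟏≤x = ≤-trans (≤-reflexive (sym (M.identityˡ _))) (·-monoˡ-≤ 𝟏≤x)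

  infixr 10 _^_
  _^_ : Carrier → ℕ → Carrier
  x ^ zero  = 𝟏
  x ^ suc n = x · x ^ n

  ^-distribˡ-+-· : ∀ x m n → x ^ (m + n) ≡ x ^ m · x ^ n
  ^-distribˡ-+-· x zero    n = sym (M.identityˡ _)
  ^-distribˡ-+-· x (suc m) n rewrite ^-distribˡ-+-· x m n = sym (M.assoc x _ _)

  ^-monoˡ-≤ : ∀ {x y} n → x ≤ y → x ^ n ≤ y ^ n
  ^-monoˡ-≤ zero    x≤y = ≤-refl
  ^-monoˡ-≤ (suc n) x≤y = ≤-trans (·-monoˡ-≤ x≤y) (·-monoʳ-≤ (^-monoˡ-≤ n x≤y))

  x≤𝟏⇒x^n≤𝟏 : ∀ {x} n → x ≤ 𝟏 → x ^ n ≤ 𝟏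
  x≤𝟏⇒x^n≤𝟏 zero    x≤𝟏 = ≤-refl
  x≤𝟏⇒x^n≤𝟏 (suc n) x≤𝟏 = ≤-trans (x≤𝟏⇒x·y≤y x≤𝟏) (x≤𝟏⇒x^n≤𝟏 n x≤𝟏)

  -- Expanding (x ∨ y)^(m+n), every product contains m factors x or n factors y,
  -- and the remaining negative factors only decrease it.
  ∨-^-≤ : ∀ {x y} m n → x ≤ 𝟏 → y ≤ 𝟏 → (x ∨ y) ^ (m + n) ≤ x ^ m ∨ y ^ n
  ∨-^-≤ zero n x≤𝟏 y≤𝟏 =
    ≤-trans (x≤𝟏⇒x^n≤𝟏 n (∨-least x≤𝟏 y≤𝟏)) (x≤x∨y _ _)
  ∨-^-≤ (suc m) zero x≤𝟏 y≤𝟏 =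
    ≤-trans (x≤𝟏⇒x^n≤𝟏 (suc m + zero) (∨-least x≤𝟏 y≤𝟏)) (y≤x∨y _ _)
  ∨-^-≤ {x} {y} (suc m) (suc n) x≤𝟏 y≤𝟏 =
    ≤-trans ·-distribʳ-∨-≤ (∨-least x-summand y-summand)
    where
    x-summand : x · (x ∨ y) ^ (m + suc n) ≤ x ^ suc m ∨ y ^ suc n
    x-summand = ≤-trans (·-monoʳ-≤ (∨-^-≤ m (suc n) x≤𝟏 y≤𝟏))
                  (≤-trans ·-distribˡ-∨-≤ (∨-mono-≤ ≤-refl (x≤𝟏⇒x·y≤y x≤𝟏)))

    fewer-y : (x ∨ y) ^ (m + suc n) ≤ x ^ suc m ∨ y ^ n
    fewer-y = subst (λ k → (x ∨ y) ^ k ≤ x ^ suc m ∨ y ^ n) (sym (+-suc m n))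
                (∨-^-≤ (suc m) n x≤𝟏 y≤𝟏)

    y-summand : y · (x ∨ y) ^ (m + suc n) ≤ x ^ suc m ∨ y ^ suc n
    y-summand = ≤-trans (·-monoʳ-≤ fewer-y)
                  (≤-trans ·-distribˡ-∨-≤ (∨-mono-≤ (x≤𝟏⇒x·y≤y y≤𝟏) ≤-refl))

module FilterProperties (A : ResiduatedLattice) where
  open ResiduatedLattice A
  open ResiduatedLatticeProperties A
  open MFilter

  ^-∈ : ∀ (F : MFilter A) {x} n → x ∈ pred F → x ^ n ∈ pred F
  ^-∈ F zero    x∈F = 𝟏∈ F
  ^-∈ F (suc n) x∈F = ·-closed F x∈F (^-∈ F n x∈F)

  ↑𝟏-mfilter : MFilter A
  ↑𝟏-mfilter = record
    { pred      = ↑𝟏 A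
    ; isMFilter = record
      { upward   = ≤-trans
      ; ∧-closed = ∧-greatest
      ; 𝟏∈       = ≤-refl
      ; ·-closed = λ 𝟏≤x 𝟏≤y → ≤-trans 𝟏≤y (𝟏≤x⇒y≤x·y 𝟏≤x)
      }
    }

  PrimeOnNegatives : MFilter A → Set
  PrimeOnNegatives F =
    ∀ {x y} → x ≤ 𝟏 → y ≤ 𝟏 → (x ∨ y) ∈ pred F → x ∈ pred F ⊎ y ∈ pred F

  module Adjoin (F : MFilter A) {a : Carrier} (a≤𝟏 : a ≤ 𝟏) where

    generator : Carrier → Carrier
    generator f = (f ∧ 𝟏) · a

    generator≤𝟏 : ∀ f → generator f ≤ 𝟏
    generator≤𝟏 f = ≤-trans (y≤𝟏⇒x·y≤x a≤𝟏) (x∧y≤y _ _)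

    generator-^-antitone : ∀ {f g x} n → generator f ^ n ≤ x → g ≤ f → generator g ^ n ≤ x
    generator-^-antitone n fⁿ≤x g≤f = ≤-trans (^-monoˡ-≤ n (·-monoˡ-≤ (∧-monoˡ-≤ g≤f))) fⁿ≤x

    Generated : Pred Carrier 0ℓ
    Generated x = Σ[ f ∈ Carrier ] Σ[ n ∈ ℕ ] f ∈ pred F × generator f ^ n ≤ x

    mfilter : MFilter A
    mfilter = record
      { pred      = Generated
      ; isMFilter = record
        { upward   = λ { (f , n , f∈F , fⁿ≤x) x≤y → f , n , f∈F , ≤-trans fⁿ≤x x≤y }
        ; ∧-closed = λ { (f , m , f∈F , fᵐ≤x) (g , n , g∈F , gⁿ≤y) →
            let h = f ∧ g in
            h , m + n , ∧-closed F f∈F g∈F ,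
            ≤-trans (≤-reflexive (^-distribˡ-+-· (generator h) m n))
              (∧-greatest
                (≤-trans (y≤𝟏⇒x·y≤x (x≤𝟏⇒x^n≤𝟏 n (generator≤𝟏 h)))
                         (generator-^-antitone m fᵐ≤x (x∧y≤x f g)))
                (≤-trans (x≤𝟏⇒x·y≤y (x≤𝟏⇒x^n≤𝟏 m (generator≤𝟏 h)))
                         (generator-^-antitone n gⁿ≤y (x∧y≤y f g)))) }
        ; 𝟏∈       = 𝟏 , zero , 𝟏∈ F , ≤-refl
        ; ·-closed = λ { (f , m , f∈F , fᵐ≤x) (g , n , g∈F , gⁿ≤y) →
            let h = f ∧ g in
            h , m + n , ∧-closed F f∈F g∈F ,
            ≤-trans (≤-reflexive (^-distribˡ-+-· (generator h) m n))
              (≤-trans (·-monoˡ-≤ (generator-^-antitone m fᵐ≤x (x∧y≤x f g)))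
                       (·-monoʳ-≤ (generator-^-antitone n gⁿ≤y (x∧y≤y f g)))) }
        }
      }

    ⊆-generated : pred F ⊆ Generated
    ⊆-generated {x} x∈F = x , 1 , x∈F ,
      ≤-trans (y≤𝟏⇒x·y≤x ≤-refl) (≤-trans (y≤𝟏⇒x·y≤x a≤𝟏) (x∧y≤x _ _))

    ∈-generated : a ∈ Generated
    ∈-generated = 𝟏 , 1 , 𝟏∈ F , ≤-trans (y≤𝟏⇒x·y≤x ≤-refl) (x≤𝟏⇒x·y≤y (x∧y≤y _ _))

  -- With h = f ∧ g ∧ 1 we have h·a ∨ h·b ≥ h·(a ∨ b) ∈ F, and
  -- (h·a ∨ h·b)^(m+n) ≤ (h·a)^m ∨ (h·b)^n ≤ x.
  generated-∩-generated⊆ : ∀ (F : MFilter A) {a b} (a≤𝟏 : a ≤ 𝟏) (b≤𝟏 : b ≤ 𝟏) →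
    (a ∨ b) ∈ pred F → Adjoin.Generated F a≤𝟏 ∩ Adjoin.Generated F b≤𝟏 ⊆ pred F
  generated-∩-generated⊆ F a≤𝟏 b≤𝟏 a∨b∈F ((f , m , f∈F , fᵐ≤x) , (g , n , g∈F , gⁿ≤x)) =
    upward F (^-∈ F (m + n) ha∨hb∈F)
      (≤-trans (∨-^-≤ m n (Fa.generator≤𝟏 (f ∧ g)) (Fb.generator≤𝟏 (f ∧ g)))
        (∨-least (Fa.generator-^-antitone m fᵐ≤x (x∧y≤x f g))
                 (Fb.generator-^-antitone n gⁿ≤x (x∧y≤y f g))))
    where
    module Fa = Adjoin F a≤𝟏
    module Fb = Adjoin F b≤𝟏

    ha∨hb∈F : (Fa.generator (f ∧ g) ∨ Fb.generator (f ∧ g)) ∈ pred F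
    ha∨hb∈F = upward F (·-closed F (∧-closed F (∧-closed F f∈F g∈F) (𝟏∈ F)) a∨b∈F)
                ·-distribˡ-∨-≤

  meetIrreducible⇒primeOnNegatives : ∀ (F : MFilter A) → MeetIrreducible A F → PrimeOnNegatives F
  meetIrreducible⇒primeOnNegatives F (_ , irreducible) a≤𝟏 b≤𝟏 a∨b∈F =
    Sum.map (λ F≐Fa → proj₂ F≐Fa Fa.∈-generated) (λ F≐Fb → proj₂ F≐Fb Fb.∈-generated)
      (irreducible Fa.mfilter Fb.mfilter
        ((λ x∈F → Fa.⊆-generated x∈F , Fb.⊆-generated x∈F) ,
         generated-∩-generated⊆ F a≤𝟏 b≤𝟏 a∨b∈F))
    where
    module Fa = Adjoin F a≤𝟏
    module Fb = Adjoin F b≤𝟏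

  completelyMeetIrreducible⇒meetIrreducible :
    ∀ (F : MFilter A) → CompletelyMeetIrreducible A F → MeetIrreducible A F
  completelyMeetIrreducible⇒meetIrreducible F cmi = F≉U , binary
    where
    F≉U : (_≐_ A (pred F) U) → ⊥
    F≉U F≐U with cmi (λ _ → Lift _ ⊥) ((λ _ _ ()) , (λ _ → proj₂ F≐U tt))
    ... | _ , () , _

    binary : ∀ (G H : MFilter A) → _≐_ A (pred F) (pred G ∩ pred H) →
             _≐_ A (pred F) (pred G) ⊎ _≐_ A (pred F) (pred H)
    binary G H F≐G∩H
      with cmi (λ K → K ≡ G ⊎ K ≡ H)
               ((λ x∈F → λ { _ (inj₁ refl) → proj₁ (proj₁ F≐G∩H x∈F)
                           ; _ (inj₂ refl) → proj₂ (proj₁ F≐G∩H x∈F) }) ,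
                (λ x∈⋂ → proj₂ F≐G∩H (x∈⋂ G (inj₁ refl) , x∈⋂ H (inj₂ refl))))
    ... | _ , inj₁ refl , F≐G = inj₁ F≐G
    ... | _ , inj₂ refl , F≐H = inj₂ F≐H

  quotient-≤⇔ : ∀ (F : MFilter A) {x y} → LΘ A F x (x ∧ y) ⇔ (𝟏 ∧ (x \\ y)) ∈ pred F
  quotient-≤⇔ F = mk⇔
    (λ (x\\x∧y∈F , _) →
      ∧-closed F (𝟏∈ F) (upward F x\\x∧y∈F (ldiv-intro (≤-trans ldiv-eval (x∧y≤y _ _)))))
    (λ 𝟏∧x\\y∈F →
      upward F 𝟏∧x\\y∈F
        (ldiv-intro (∧-greatest (y≤𝟏⇒x·y≤x (x∧y≤x _ _))
                                (≤-trans (·-monoʳ-≤ (x∧y≤y _ _)) ldiv-eval))) ,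
      upward F (𝟏∈ F) (ldiv-intro (≤-trans (y≤𝟏⇒x·y≤x ≤-refl) (x∧y≤x _ _))))

  quotient-atom⇔ : ∀ (F : MFilter A) ρ (t≤u : Atom) → SatAtom (Quotient A F) ρ t≤u ⇔
    (𝟏 ∧ (⟦_⟧ᴬ A (proj₁ t≤u) ρ \\ ⟦_⟧ᴬ A (proj₂ t≤u) ρ)) ∈ pred F
  quotient-atom⇔ F ρ (t , u) = quotient-≤⇔ F

  ⋁⁺ : {B : Set} → (B → Carrier) → List⁺ B → Carrier
  ⋁⁺ g bs = foldr₁ _∨_ (map⁺ g bs)

  ⋁⁺-least : ∀ {B : Set} {g : B → Carrier} {z} bs → (∀ b → g b ≤ z) → ⋁⁺ g bs ≤ z
  ⋁⁺-least {g = g} {z} (b ∷ bs) g≤z = go b bs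
    where
    go : ∀ b bs → ⋁⁺ g (b ∷ bs) ≤ z
    go b []       = g≤z b
    go b (c ∷ bs) = ∨-least (g≤z b) (go c bs)

  ⋁⁺-∈ : ∀ {B : Set} {g : B → Carrier} (F : MFilter A) bs →
         Any (λ b → g b ∈ pred F) (toList bs) → ⋁⁺ g bs ∈ pred F
  ⋁⁺-∈ {g = g} F (b ∷ bs) = go b bs
    where
    go : ∀ b bs → Any (λ b → g b ∈ pred F) (b ∷ bs) → ⋁⁺ g (b ∷ bs) ∈ pred F
    go b []       (here gb∈F) = gb∈F
    go b (c ∷ bs) (here gb∈F) = upward F gb∈F (x≤x∨y _ _)
    go b (c ∷ bs) (there any) = upward F (go c bs any) (y≤x∨y _ _)

  primeOnNegatives-⋁⁺ : ∀ {B : Set} {g : B → Carrier} (F : MFilter A) → PrimeOnNegatives F →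
    (∀ b → g b ≤ 𝟏) → ∀ bs → ⋁⁺ g bs ∈ pred F → Any (λ b → g b ∈ pred F) (toList bs)
  primeOnNegatives-⋁⁺ {g = g} F prime g≤𝟏 (b ∷ bs) = go b bs
    where
    go : ∀ b bs → ⋁⁺ g (b ∷ bs) ∈ pred F → Any (λ b → g b ∈ pred F) (b ∷ bs)
    go b []       gb∈F = here gb∈F
    go b (c ∷ bs) ⋁∈F with prime (g≤𝟏 b) (⋁⁺-least (c ∷ bs) g≤𝟏) ⋁∈F
    ... | inj₁ gb∈F   = here gb∈F
    ... | inj₂ rest∈F = there (go c bs rest∈F)

  preTerm≤𝟏 : ∀ ρ Φ → preTerm A ρ Φ ≤ 𝟏
  preTerm≤𝟏 ρ Φ = ⋁⁺-least Φ (λ _ → x∧y≤x _ _)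

  quotient⊨⇒preTerm∈ : ∀ {Φ} (F : MFilter A) → Quotient A F ⊨ Φ → ∀ ρ → preTerm A ρ Φ ∈ pred F
  quotient⊨⇒preTerm∈ {Φ} F F⊨Φ ρ =
    ⋁⁺-∈ F Φ (Any.map (λ {t≤u} → Equivalence.to (quotient-atom⇔ F ρ t≤u)) (F⊨Φ ρ))

  satisfiesPre⇒quotient⊨ : ∀ {Φ} → SatisfiesPre A Φ →
    ∀ (F : MFilter A) → PrimeOnNegatives F → Quotient A F ⊨ Φ
  satisfiesPre⇒quotient⊨ {Φ} pre F prime ρ =
    Any.map (λ {t≤u} → Equivalence.from (quotient-atom⇔ F ρ t≤u))
      (primeOnNegatives-⋁⁺ F prime (λ _ → x∧y≤x _ _) Φ (subst (_∈ pred F) (sym (pre ρ)) (𝟏∈ F)))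

module MaximalFilters (em : ExcludedMiddle (lsuc (lsuc 0ℓ)))
                      (zorn : Zorn (lsuc 0ℓ) 0ℓ (lsuc 0ℓ))
                      (A : ResiduatedLattice) where
  open ResiduatedLattice A using (Carrier; _≤_)
  open MFilter

  decide : (P : Set₁) → Dec P
  decide P = map′ lower lift (em {Lift (lsuc (lsuc 0ℓ)) P})

  decide₀ : (P : Set) → Dec P
  decide₀ P = map′ lower lift (decide (Lift (lsuc 0ℓ) P))

  Avoids : MFilter A → Carrier → MFilter A → Set
  Avoids F x G = (pred F ⊆ pred G) × (x ∉ pred G)

  MaximalAvoiding : MFilter A → Carrier → MFilter A → Set₁
  MaximalAvoiding F x G =
    Avoids F x G × (∀ H → Avoids F x H → pred G ⊆ pred H → pred H ⊆ pred G)

  -- A member of S omitting x contains G, hence equals G by maximality;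
  -- if there were none, x would lie in ⋂ S = G.
  maximalAvoiding⇒completelyMeetIrreducible :
    ∀ {F x G} → MaximalAvoiding F x G → CompletelyMeetIrreducible A G
  maximalAvoiding⇒completelyMeetIrreducible {F} {x} {G} ((F⊆G , x∉G) , maximal) S G≐⋂S
    with decide (Σ[ H ∈ MFilter A ] S H × x ∉ pred H)
  ... | yes (H , H∈S , x∉H) = H , H∈S , G⊆H , maximal H ((G⊆H ∘ F⊆G) , x∉H) G⊆H
    where
    G⊆H : pred G ⊆ pred H
    G⊆H y∈G = proj₁ G≐⋂S y∈G H H∈S
  ... | no ∄H = ⊥-elim (x∉G (proj₂ G≐⋂S λ H H∈S →
          decidable-stable (decide₀ (x ∈ pred H)) (λ x∉H → ∄H (H , H∈S , x∉H))))

  module ChainUnion (F : MFilter A) (x : Carrier) (x∉F : x ∉ pred F) where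

    Candidate : Set₁
    Candidate = Σ (MFilter A) (Avoids F x)

    _⊑_ : Candidate → Candidate → Set
    (G , _) ⊑ (H , _) = pred G ⊆ pred H

    module _ (C : Pred Candidate (lsuc 0ℓ))
             (chain : ∀ {G H} → C G → C H → G ⊑ H ⊎ H ⊑ G) where

      -- F is included so that the empty chain has an upper bound too.
      InUnion : Carrier → Set₁
      InUnion y = y ∈ pred F ⊎ Σ[ G ∈ Candidate ] C G × y ∈ pred (proj₁ G)

      InUnion-closed : ∀ {y z w} →
        (∀ (G : MFilter A) → y ∈ pred G → z ∈ pred G → w ∈ pred G) →
        InUnion y → InUnion z → InUnion w
      InUnion-closed closed (inj₁ y∈F) (inj₁ z∈F) = inj₁ (closed F y∈F z∈F)
      InUnion-closed closed (inj₁ y∈F) (inj₂ (G , G∈C , z∈G)) =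
        inj₂ (G , G∈C , closed (proj₁ G) (proj₁ (proj₂ G) y∈F) z∈G)
      InUnion-closed closed (inj₂ (G , G∈C , y∈G)) (inj₁ z∈F) =
        inj₂ (G , G∈C , closed (proj₁ G) y∈G (proj₁ (proj₂ G) z∈F))
      InUnion-closed closed (inj₂ (G , G∈C , y∈G)) (inj₂ (H , H∈C , z∈H))
        with chain G∈C H∈C
      ... | inj₁ G⊑H = inj₂ (H , H∈C , closed (proj₁ H) (G⊑H y∈G) z∈H)
      ... | inj₂ H⊑G = inj₂ (G , G∈C , closed (proj₁ G) y∈G (H⊑G z∈H))

      InUnion-upward : ∀ {y z} → InUnion y → y ≤ z → InUnion z
      InUnion-upward (inj₁ y∈F) y≤z = inj₁ (upward F y∈F y≤z)
      InUnion-upward (inj₂ (G , G∈C , y∈G)) y≤z = inj₂ (G , G∈C , upward (proj₁ G) y∈G y≤z)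

      x∉Union : InUnion x → ⊥
      x∉Union (inj₁ x∈F) = x∉F x∈F
      x∉Union (inj₂ (G , _ , x∈G)) = proj₂ (proj₂ G) x∈G

      -- InUnion is Set₁-valued; excluded middle lets it be truncated to a
      -- Set-valued predicate, as the carrier of an MFilter must be.
      union : MFilter A
      union = record
        { pred      = λ y → True (decide (InUnion y))
        ; isMFilter = record
          { upward   = λ y∈ y≤z → fromWitness (InUnion-upward (toWitness y∈) y≤z)
          ; ∧-closed = λ y∈ z∈ →
              fromWitness (InUnion-closed (λ G → ∧-closed G) (toWitness y∈) (toWitness z∈))
          ; 𝟏∈       = fromWitness (inj₁ (𝟏∈ F))
          ; ·-closed = λ y∈ z∈ →
              fromWitness (InUnion-closed (λ G → ·-closed G) (toWitness y∈) (toWitness z∈))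
          }
        }

      upperBound : Σ[ U ∈ Candidate ] (∀ {G} → C G → G ⊑ U)
      upperBound = (union , (λ y∈F → fromWitness (inj₁ y∈F)) , x∉Union ∘ toWitness) ,
                   λ {G} G∈C y∈G → fromWitness (inj₂ (G , G∈C , y∈G))

    maximalAvoiding : Σ (MFilter A) (MaximalAvoiding F x)
    maximalAvoiding with zorn Candidate _⊑_ (λ y∈ → y∈) (λ G⊑H H⊑K → H⊑K ∘ G⊑H) upperBound
    ... | (G , G-avoids) , maximal =
      G , G-avoids , λ H H-avoids G⊆H → maximal (H , H-avoids) G⊆H

  MaximalAvoidingSome : MFilter A → Pred (MFilter A) (lsuc 0ℓ)
  MaximalAvoidingSome F G = Σ[ x ∈ Carrier ] MaximalAvoiding F x G

  ≐⋂maximalAvoiding : ∀ (F : MFilter A) → _≐_ A (pred F) (⋂ A (MaximalAvoidingSome F))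
  ≐⋂maximalAvoiding F =
    (λ y∈F G (_ , (F⊆G , _) , _) → F⊆G y∈F) ,
    λ {y} y∈⋂ → decidable-stable (decide₀ (y ∈ pred F)) λ y∉F →
      let (G , G-maximal) = ChainUnion.maximalAvoiding F y y∉F
      in proj₂ (proj₁ G-maximal) (y∈⋂ G (y , G-maximal))

module _ {I : Set} (Φ : I → Sentence) (A : ResiduatedLattice) where
  open ResiduatedLatticeProperties A using (≤-antisym)
  open FilterProperties A
  open MFilter

  LeftPreK : Set
  LeftPreK = ∀ i → SatisfiesPre A (Φ i)

  MeetIrreduciblesAreLeftK : Set₁
  MeetIrreduciblesAreLeftK = ∀ (F : MFilter A) → MeetIrreducible A F → IsLeftKFilter A Φ F

  CompletelyMeetIrreduciblesAreLeftK : Set₂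
  CompletelyMeetIrreduciblesAreLeftK = ∀ (F : MFilter A) → CompletelyMeetIrreducible A F → IsLeftKFilter A Φ F

  ↑𝟏IsIntersectionOfLeftK : Set₂
  ↑𝟏IsIntersectionOfLeftK = IsIntersectionOfLeftKFilters A Φ (↑𝟏 A)

  FiltersAreIntersectionsOfLeftK : Set₂
  FiltersAreIntersectionsOfLeftK = ∀ (F : MFilter A) → IsIntersectionOfLeftKFilters A Φ (pred F)

  leftPreK⇒meetIrreduciblesAreLeftK : LeftPreK → MeetIrreduciblesAreLeftK
  leftPreK⇒meetIrreduciblesAreLeftK pre F F-mi i =
    satisfiesPre⇒quotient⊨ (pre i) F (meetIrreducible⇒primeOnNegatives F F-mi)

  meetIrreduciblesAreLeftK⇒completelyMeetIrreduciblesAreLeftK :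
    MeetIrreduciblesAreLeftK → CompletelyMeetIrreduciblesAreLeftK
  meetIrreduciblesAreLeftK⇒completelyMeetIrreduciblesAreLeftK mi⇒K F =
    mi⇒K F ∘ completelyMeetIrreducible⇒meetIrreducible F

  completelyMeetIrreduciblesAreLeftK⇒filtersAreIntersectionsOfLeftK :
    ExcludedMiddle (lsuc (lsuc 0ℓ)) → Zorn (lsuc 0ℓ) 0ℓ (lsuc 0ℓ) →
    CompletelyMeetIrreduciblesAreLeftK → FiltersAreIntersectionsOfLeftK
  completelyMeetIrreduciblesAreLeftK⇒filtersAreIntersectionsOfLeftK em zorn cmi⇒K F =
    MaximalAvoidingSome F , (λ G (x , G-maximal) →
      cmi⇒K G (maximalAvoiding⇒completelyMeetIrreducible {F} {x} {G} G-maximal)) ,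
    ≐⋂maximalAvoiding F
    where open MaximalFilters em zorn A

  filtersAreIntersectionsOfLeftK⇒↑𝟏IsIntersectionOfLeftK :
    FiltersAreIntersectionsOfLeftK → ↑𝟏IsIntersectionOfLeftK
  filtersAreIntersectionsOfLeftK⇒↑𝟏IsIntersectionOfLeftK all = all ↑𝟏-mfilter

  ↑𝟏IsIntersectionOfLeftK⇒leftPreK : ↑𝟏IsIntersectionOfLeftK → LeftPreK
  ↑𝟏IsIntersectionOfLeftK⇒leftPreK (S , S-leftK , ↑𝟏≐⋂S) i ρ =
    ≤-antisym (preTerm≤𝟏 ρ (Φ i))
      (proj₂ ↑𝟏≐⋂S λ G G∈S → quotient⊨⇒preTerm∈ G (S-leftK G G∈S i) ρ)

theorem3p26 : ExcludedMiddle (lsuc (lsuc 0ℓ)) → Zorn (lsuc 0ℓ) 0ℓ (lsuc 0ℓ) →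
    {I : Set} (Φ : I → Sentence) (A : ResiduatedLattice) →
    ((∀ i → SatisfiesPre A (Φ i))
      ⇔ (∀ (F : MFilter A) → MeetIrreducible A F → IsLeftKFilter A Φ F))
    × ((∀ i → SatisfiesPre A (Φ i))
      ⇔ (∀ (F : MFilter A) → CompletelyMeetIrreducible A F → IsLeftKFilter A Φ F))
    × ((∀ i → SatisfiesPre A (Φ i))
      ⇔ IsIntersectionOfLeftKFilters A Φ (↑𝟏 A))
    × ((∀ i → SatisfiesPre A (Φ i))
      ⇔ (∀ (F : MFilter A) → IsIntersectionOfLeftKFilters A Φ (MFilter.pred F)))
theorem3p26 em zorn Φ A =
  mk⇔ i⇒ii (ii′⇒i ∘ ii⇒ii′) , mk⇔ (ii⇒ii′ ∘ i⇒ii) ii′⇒i ,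
  mk⇔ (iv⇒iii ∘ i⇒iv) iii⇒i , mk⇔ i⇒iv (iii⇒i ∘ iv⇒iii)
  where
  i⇒ii : LeftPreK Φ A → MeetIrreduciblesAreLeftK Φ A
  i⇒ii = leftPreK⇒meetIrreduciblesAreLeftK Φ A

  ii⇒ii′ : MeetIrreduciblesAreLeftK Φ A → CompletelyMeetIrreduciblesAreLeftK Φ A
  ii⇒ii′ = meetIrreduciblesAreLeftK⇒completelyMeetIrreduciblesAreLeftK Φ A

  ii′⇒iv : CompletelyMeetIrreduciblesAreLeftK Φ A → FiltersAreIntersectionsOfLeftK Φ A
  ii′⇒iv = completelyMeetIrreduciblesAreLeftK⇒filtersAreIntersectionsOfLeftK Φ A em zorn

  iv⇒iii : FiltersAreIntersectionsOfLeftK Φ A → ↑𝟏IsIntersectionOfLeftK Φ A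
  iv⇒iii = filtersAreIntersectionsOfLeftK⇒↑𝟏IsIntersectionOfLeftK Φ A

  iii⇒i : ↑𝟏IsIntersectionOfLeftK Φ A → LeftPreK Φ A
  iii⇒i = ↑𝟏IsIntersectionOfLeftK⇒leftPreK Φ A

  i⇒iv : LeftPreK Φ A → FiltersAreIntersectionsOfLeftK Φ A
  i⇒iv = ii′⇒iv ∘ ii⇒ii′ ∘ i⇒ii

  ii′⇒i : CompletelyMeetIrreduciblesAreLeftK Φ A → LeftPreK Φ A
  ii′⇒i = iii⇒i ∘ iv⇒iii ∘ ii′⇒iv
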